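{- Let $R$ and $R'$ be (not necessarily commutative) subrings of a $\mathbb Q$-algebra and let $d\geq1$ be an integer. Suppose $dR\subseteq R'$ and $R'\subseteq R$. Then $|R^\times/R'^\times|\leq|R/dR|$.
   Context: $R^\times$ denotes the unit group of $R$; $R'^\times$ is a subgroup of $R^\times$ and $R^\times/R'^\times$ is the set of its cosets. -}

module Defs where

open import Level using (Level; _⊔_) renaming (suc to lsuc)
open import Data.Nat using (ℕ)
open import Data.Product using (Σ; _×_; ∃-syntax; proj₁)
open import Relation.Binary.PropositionalEquality using (_≡_)
open import Algebra.Bundles using (Ring)
open import Algebra.Morphism.Structures using (module RingMorphisms)
open import Data.Rational using (ℚ)
import Data.Rational.Properties as ℚP
import Algebra.Definitions.RawMonoid as RawMonoidDefs

record QAlgebra (c ℓ : Level) : Set (lsuc (c ⊔ ℓ)) where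
  field
    ring : Ring c ℓ
  open Ring ring
  open RingMorphisms (Ring.rawRing ℚP.+-*-ring) rawRing
  field
    ι         : ℚ → Carrier
    ι-hom     : IsRingHomomorphism ι
    ι-central : ∀ q x → ι q * x ≈ x * ι q

module _ {c ℓ : Level} (A : QAlgebra c ℓ) where
  open QAlgebra A
  open Ring ring

  record Subring (p : Level) : Set (c ⊔ ℓ ⊔ lsuc p) where
    field
      mem    : Carrier → Set p
      resp   : ∀ {x y} → x ≈ y → mem x → mem y
      0#∈    : mem 0#
      1#∈    : mem 1#
      +-closed : ∀ {x y} → mem x → mem y → mem (x + y)
      neg-closed : ∀ {x} → mem x → mem (- x)
      *-closed : ∀ {x y} → mem x → mem y → mem (x * y)

  open Subring public

  _⊆_ : ∀ {p q} → Subring p → Subring q → Set (c ⊔ p ⊔ q)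
  S ⊆ T = ∀ {x} → mem S x → mem T x

  _·_ : ℕ → Carrier → Carrier
  d · x = RawMonoidDefs._×_ +-rawMonoid d x

  _∈_*_ : ∀ {p} → Carrier → ℕ → Subring p → Set (c ⊔ ℓ ⊔ p)
  x ∈ d * R = ∃[ r ] (mem R r × x ≈ d · r)

  _*_⊆_ : ∀ {p q} → ℕ → Subring p → Subring q → Set (c ⊔ ℓ ⊔ p ⊔ q)
  d * R ⊆ R' = ∀ {x} → x ∈ d * R → mem R' x

  IsUnit : ∀ {p} → Subring p → Carrier → Set (c ⊔ ℓ ⊔ p)
  IsUnit R u = mem R u × ∃[ v ] (mem R v × (u * v ≈ 1#) × (v * u ≈ 1#))

  Units : ∀ {p} → Subring p → Set (c ⊔ ℓ ⊔ p)
  Units R = Σ Carrier (IsUnit R)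

  SameCoset : ∀ {q} → Subring q → Carrier → Carrier → Set (c ⊔ ℓ ⊔ q)
  SameCoset R' u v = ∃[ w ] (IsUnit R' w × v ≈ u * w)

  CongMod : ∀ {p} → ℕ → Subring p → Carrier → Carrier → Set (c ⊔ ℓ ⊔ p)
  CongMod d R a b = (a - b) ∈ d * R

  -- |R^×/R'^×| ≤ |R/dR| : every family of units of R lying in pairwise distinct
  -- cosets of R'^× admits an injective assignment of classes of R/dR
  -- (i.e. any set of distinct cosets injects into R/dR).
  IndexLeq : ∀ {p q} (i : Level) → Subring p → Subring q → ℕ → Set (c ⊔ ℓ ⊔ p ⊔ q ⊔ lsuc i)
  IndexLeq i R R' d =
    (I : Set i) (u : I → Units R) →
    (∀ j k → SameCoset R' (proj₁ (u j)) (proj₁ (u k)) → j ≡ k) →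
    Σ (I → Carrier) λ f → (∀ j → mem R (f j)) × (∀ j k → CongMod d R (f j) (f k) → j ≡ k)

{-# OPTIONS --safe #-}
-- If units a, b of R satisfy a ≡ b (mod dR), then a⁻¹b ∈ 1 + dR and its inverse
-- b⁻¹a ∈ 1 + dR, and 1 + dR ⊆ R' because dR ⊆ R'. So a⁻¹b ∈ R'^×, i.e. a and b lie
-- in the same coset of R'^×, and u ↦ u mod dR is injective on R^×/R'^×.
module Submission where

open import Defs
open import Level using (Level)
open import Data.Nat using (ℕ; _≤_)
open import Data.Product using (_,_; proj₁; proj₂)
open import Algebra.Bundles using (Ring)
import Algebra.Properties.Group as GroupProperties
import Algebra.Properties.Monoid as MonoidProperties
import Algebra.Properties.RingWithoutOne as RingWithoutOneProperties
import Relation.Binary.Reasoning.Setoid as SetoidReasoning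

module RingProperties {c ℓ} (R : Ring c ℓ) where
  open Ring R
  open GroupProperties +-group using (//-rightDividesˡ; x≈z//y)
  open RingWithoutOneProperties ringWithoutOne using (x[y-z]≈xy-xz)

  x-y≈z⇒x≈y+z : ∀ {x y z} → x - y ≈ z → x ≈ y + z
  x-y≈z⇒x≈y+z {x} {y} {z} x-y≈z = trans (sym (//-rightDividesˡ y x))
                                        (trans (+-congʳ x-y≈z) (+-comm z y))

  x-y≈z⇒y≈x-z : ∀ {x y z} → x - y ≈ z → y ≈ x - z
  x-y≈z⇒y≈x-z {x} {y} {z} x-y≈z = x≈z//y y z x (sym (x-y≈z⇒x≈y+z x-y≈z))

  module _ {a a' : Carrier} (a'a≈1 : a' * a ≈ 1#) where

    a'[a+x]≈1+a'x : ∀ x → a' * (a + x) ≈ 1# + a' * x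
    a'[a+x]≈1+a'x x = trans (distribˡ a' a x) (+-congʳ a'a≈1)

    a'[a-x]≈1-a'x : ∀ x → a' * (a - x) ≈ 1# - a' * x
    a'[a-x]≈1-a'x x = trans (x[y-z]≈xy-xz a' a x) (+-congʳ a'a≈1)

module _ {c ℓ : Level} (A : QAlgebra c ℓ) where
  open QAlgebra A
  open Ring ring
  open RingProperties ring
  open MonoidProperties *-monoid using (cancelᶜ; insertˡ)
  open import Algebra.Properties.Semiring.Mult semiring using (×-comm-*)
  open SetoidReasoning setoid

  module _ {p q : Level} (R : Subring A p) (R' : Subring A q) (d : ℕ) (dR⊆R' : _*_⊆_ A d R R') where

    1+dR⊆R' : ∀ {x r} → mem R r → x ≈ 1# + _·_ A d r → mem R' x
    1+dR⊆R' {r = r} r∈R x≈1+dr =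
      resp R' (sym x≈1+dr) (+-closed R' (1#∈ R') (dR⊆R' (r , r∈R , refl)))

    1-dR⊆R' : ∀ {x r} → mem R r → x ≈ 1# - _·_ A d r → mem R' x
    1-dR⊆R' {r = r} r∈R x≈1-dr =
      resp R' (sym x≈1-dr) (+-closed R' (1#∈ R') (neg-closed R' (dR⊆R' (r , r∈R , refl))))

    congMod⇒sameCoset : (u v : Units A R) →
                        CongMod A d R (proj₁ u) (proj₁ v) → SameCoset A R' (proj₁ u) (proj₁ v)
    congMod⇒sameCoset (a , _ , a' , a'∈R , aa'≈1 , a'a≈1) (b , _ , b' , b'∈R , bb'≈1 , b'b≈1)
                      (r , r∈R , a-b≈dr) =
      a' * b , (a'b∈R' , b' * a , b'a∈R' , a'b∙b'a≈1 , b'a∙a'b≈1) , insertˡ aa'≈1 b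
      where
      a'b≈1-da'r : a' * b ≈ 1# - _·_ A d (a' * r)
      a'b≈1-da'r = begin
        a' * b                 ≈⟨ *-congˡ (x-y≈z⇒y≈x-z a-b≈dr) ⟩
        a' * (a - _·_ A d r)   ≈⟨ a'[a-x]≈1-a'x a'a≈1 (_·_ A d r) ⟩
        1# - a' * _·_ A d r    ≈⟨ +-congˡ (-‿cong (×-comm-* d a' r)) ⟩
        1# - _·_ A d (a' * r)  ∎

      b'a≈1+db'r : b' * a ≈ 1# + _·_ A d (b' * r)
      b'a≈1+db'r = begin
        b' * a                 ≈⟨ *-congˡ (x-y≈z⇒x≈y+z a-b≈dr) ⟩
        b' * (b + _·_ A d r)   ≈⟨ a'[a+x]≈1+a'x b'b≈1 (_·_ A d r) ⟩
        1# + b' * _·_ A d r    ≈⟨ +-congˡ (×-comm-* d b' r) ⟩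
        1# + _·_ A d (b' * r)  ∎

      a'b∈R' : mem R' (a' * b)
      a'b∈R' = 1-dR⊆R' (*-closed R a'∈R r∈R) a'b≈1-da'r

      b'a∈R' : mem R' (b' * a)
      b'a∈R' = 1+dR⊆R' (*-closed R b'∈R r∈R) b'a≈1+db'r

      a'b∙b'a≈1 : (a' * b) * (b' * a) ≈ 1#
      a'b∙b'a≈1 = trans (cancelᶜ bb'≈1 a' a) a'a≈1

      b'a∙a'b≈1 : (b' * a) * (a' * b) ≈ 1#
      b'a∙a'b≈1 = trans (cancelᶜ aa'≈1 b' b) b'b≈1

lemma10p11 : ∀ {c ℓ p q : Level} (i : Level) (A : QAlgebra c ℓ)
             (R : Subring A p) (R' : Subring A q) (d : ℕ) → 1 ≤ d →
             _*_⊆_ A d R R' → _⊆_ A R' R →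
             IndexLeq A i R R' d
lemma10p11 i A R R' d _ dR⊆R' _ I u distinctCosets =
  (λ j → proj₁ (u j)) ,
  (λ j → proj₁ (proj₂ (u j))) ,
  λ j k fj≡fk → distinctCosets j k (congMod⇒sameCoset A R R' d dR⊆R' (u j) (u k) fj≡fk)
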